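{- There exists no $n$ which is $\frac{1}{\sqrt5}\phi^{ -1}$-paradoxical. Equivalently, for $n\ge2$: if $\delta_n<\frac1{\sqrt5}\phi^{ -1}$ then $n\in D$, and if $\Delta_n<\frac1{\sqrt5}\phi^{ -1}$ then $n\in U$.
   Context: $\phi=(1+\sqrt5)/2$. For positive integers $a_1,a_2$, the $(a_1,a_2)$-Fibonacci walk is $w_k=w_k(a_1,a_2)$ with $w_1=a_1$, $w_2=a_2$, $w_{k+2}=w_{k+1}+w_k$. Let $s(n;a_1,a_2)$ be the integer $s$ with $w_s(a_1,a_2)=n$ ($-\infty$ if none), and $s(n)=\max_{a_1,a_2\ge1}s(n;a_1,a_2)$. A pair $(a_1,a_2)$ is $n$-good if $a_1,a_2\ge1$ and $s(n;a_1,a_2)=s(n)$; its walk is then an $n$-slow Fibonacci walk. An integer $n\ge2$ is in $D$ if $w_{s(n)+1}=\lfloor\phi n\rfloor$ for some $n$-slow walk, and in $U$ if $w_{s(n)+1}=\lceil\phi n\rceil$ for some $n$-slow walk (every $n\ge2$ lies in exactly one of $D,U$). Let $\delta_n=\phi n-\lfloor\phi n\rfloor$, $\Delta_n=\lceil\phi n\rceil-\phi n$. An integer $n$ is $d$-paradoxical if either ($\delta_n<d$ and $n\in U$) or ($\Delta_n<d$ and $n\in D$). -}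

module Defs where

open import Data.Nat as ℕ using (ℕ; zero; suc)
open import Data.Integer as ℤ using (ℤ; +_)
open import Data.Rational as Q using (ℚ; 0ℚ; 1ℚ; _/_)
open import Data.Product using (Σ; _×_; ∃)
open import Data.Sum using (_⊎_)
open import Relation.Binary.PropositionalEquality using (_≡_)

-- Fibonacci walks
-- w a₁ a₂ k = w_k(a₁,a₂) for k ≥ 1 (index 0 is an unused dummy value).

w : ℕ → ℕ → ℕ → ℕ
w a₁ a₂ zero                = 0
w a₁ a₂ (suc zero)          = a₁
w a₁ a₂ (suc (suc zero))    = a₂
w a₁ a₂ (suc (suc (suc k))) = w a₁ a₂ (suc (suc k)) ℕ.+ w a₁ a₂ (suc k)

-- (a₁,a₂) is n-good and s = s(n): w_s(a₁,a₂) = n, and no walk with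
-- positive starting values reaches n at an index larger than s.
Slow : ℕ → ℕ → ℕ → ℕ → Set
Slow n a₁ a₂ s =
  (1 ℕ.≤ a₁) × (1 ℕ.≤ a₂) × (1 ℕ.≤ s) × (w a₁ a₂ s ≡ n) ×
  (∀ b₁ b₂ t → 1 ℕ.≤ b₁ → 1 ℕ.≤ b₂ → 1 ℕ.≤ t → w b₁ b₂ t ≡ n → t ℕ.≤ s)

-- The real quadratic field ℚ(√5): the pair (a , b) denotes a + b√5,
-- with √5 the positive square root of 5.

record Q5 : Set where
  constructor _⊹_√5
  field
    re : ℚ
    ir : ℚ
open Q5 public

five : ℚ
five = + 5 / 1

infixl 6 _+₅_ _-₅_
infixl 7 _*₅_
infix 4 _<₅_ _≤₅_

_+₅_ : Q5 → Q5 → Q5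
(a ⊹ b √5) +₅ (c ⊹ d √5) = (a Q.+ c) ⊹ (b Q.+ d) √5

_-₅_ : Q5 → Q5 → Q5
(a ⊹ b √5) -₅ (c ⊹ d √5) = (a Q.- c) ⊹ (b Q.- d) √5

_*₅_ : Q5 → Q5 → Q5
(a ⊹ b √5) *₅ (c ⊹ d √5) = (a Q.* c Q.+ five Q.* (b Q.* d)) ⊹ (a Q.* d Q.+ b Q.* c) √5

fromℕ₅ : ℕ → Q5
fromℕ₅ n = (+ n / 1) ⊹ 0ℚ √5

one₅ : Q5
one₅ = 1ℚ ⊹ 0ℚ √5

√5 : Q5
√5 = 0ℚ ⊹ 1ℚ √5

φ : Q5
φ = (+ 1 / 2) ⊹ (+ 1 / 2) √5

-- Positivity of a + b√5 (as a real number).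
data Pos : Q5 → Set where
  pos-nn : ∀ {a b} → 0ℚ Q.≤ a → 0ℚ Q.≤ b → 0ℚ Q.< a Q.+ b → Pos (a ⊹ b √5)
  pos-pn : ∀ {a b} → 0ℚ Q.< a → b Q.< 0ℚ → five Q.* (b Q.* b) Q.< a Q.* a → Pos (a ⊹ b √5)
  pos-np : ∀ {a b} → a Q.< 0ℚ → 0ℚ Q.< b → a Q.* a Q.< five Q.* (b Q.* b) → Pos (a ⊹ b √5)

_<₅_ : Q5 → Q5 → Set
x <₅ y = Pos (y -₅ x)

_≤₅_ : Q5 → Q5 → Set
x ≤₅ y = x <₅ y ⊎ x ≡ y

IsFloor : Q5 → ℕ → Set
IsFloor x k = (fromℕ₅ k ≤₅ x) × (x <₅ fromℕ₅ (suc k))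

IsCeil : Q5 → ℕ → Set
IsCeil x k = (x ≤₅ fromℕ₅ k) × (fromℕ₅ k -₅ one₅ <₅ x)

InD : ℕ → Set
InD n = ∃ λ a₁ → ∃ λ a₂ → ∃ λ s →
  Slow n a₁ a₂ s × IsFloor (φ *₅ fromℕ₅ n) (w a₁ a₂ (suc s))

InU : ℕ → Set
InU n = ∃ λ a₁ → ∃ λ a₂ → ∃ λ s →
  Slow n a₁ a₂ s × IsCeil (φ *₅ fromℕ₅ n) (w a₁ a₂ (suc s))

-- If m is ⌊φn⌋ or ⌈φn⌉ with |φn − m| < c = 1/(√5 φ), then |√5 (m − φn)| < φ⁻¹.  Run the
-- walk (n , m) backwards, (x , y) ↦ (y − x , x), until it stops increasing: this gives a walk
-- a₁ ≥ a₂ ≥ 1 reaching n at step s + 1, and its predecessor value w₀ = a₂ − a₁ ≤ 0.  Each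
-- backward step multiplies the error y − φx by −φ, so √5 (a₁ − φ w₀) < φ^s.  A positive walk
-- (c₁ , c₂) reaching n at a later step satisfies c₁ F_s + c₂ F_{s+1} = w₀ F_s + a₁ F_{s+1} after
-- shifting, and as F_s, F_{s+1} are coprime this forces a₁ > F_s; but then √5 a₁ > φ^s, since
-- φ^s − √5 F_s = (1 − φ)^s.  So the backward walk is slow, and its next value is m.
-- All arithmetic takes place in ℤ[φ], with positivity of a + b√5 decided exactly over ℤ.

module Submission where

open import Defs
open import Data.Nat using (ℕ; _≤_)
open import Data.Product using (_×_)
open import Relation.Binary.PropositionalEquality using (_≡_)

open import Data.Nat as ℕ using (zero; suc; z≤n; s≤s)
import Data.Nat.Properties as ℕₚ
open import Data.Integer as ℤ
  using (ℤ; +_; -[1+_]; 0ℤ; 1ℤ; -1ℤ; _+_; _*_; _-_; -_; _<_; +≤+; nonNegative; positive)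
  renaming (_≤_ to _≤ᶻ_)
open import Data.Integer.Properties
open import Data.Integer.Tactic.RingSolver using (solve-∀)
open import Data.Rational as ℚ using (ℚ; mkℚ; 0ℚ; 1ℚ; _/_)
import Data.Rational.Properties as ℚₚ
import Tactic.RingSolver as RingSolver
import Tactic.RingSolver.Core.AlmostCommutativeRing as ACR
open import Level using (0ℓ)
open import Relation.Nullary.Decidable.Core using (dec⇒maybe)
import Data.Nat.Coprimality as Coprime
open import Data.Integer.GCD using (gcd; gcd-zeroʳ)
open import Data.Product using (∃; _,_; proj₁; proj₂)
open import Data.Sum using (_⊎_; inj₁; inj₂)
open import Data.Empty using (⊥; ⊥-elim)
open import Relation.Nullary using (yes; no)
open import Relation.Binary.PropositionalEquality
  using (refl; sym; trans; cong; cong₂; subst; subst₂; module ≡-Reasoning)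
open ≡-Reasoning

-- Integer inequalities are proved by certificates: the difference (minus 1, for a strict
-- inequality) is a sum of products of known nonnegative terms, equal to it by a ring identity.
infix 4 0≤_
0≤_ : ℤ → Set
0≤ x = 0ℤ ≤ᶻ x

0≤-by : ∀ {a b} → a ≡ b → 0≤ a → 0≤ b
0≤-by = subst 0≤_

0<-by : ∀ {a b} → a ≡ b → 0ℤ < a → 0ℤ < b
0<-by = subst (0ℤ <_)

0<1 : 0ℤ < 1ℤ
0<1 = ℤ.+<+ (s≤s z≤n)

0≤-+ : ∀ {a b} → 0≤ a → 0≤ b → 0≤ a + b
0≤-+ = +-mono-≤

0≤-* : ∀ {a b} → 0≤ a → 0≤ b → 0≤ a * b
0≤-* {a} {b} 0≤a 0≤b = subst (_≤ᶻ a * b) (*-zeroˡ b) (*-monoʳ-≤-nonNeg b ⦃ nonNegative 0≤b ⦄ 0≤a)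

0≤+ : ∀ n → 0≤ + n
0≤+ n = +≤+ z≤n

¬0≤-[1+_] : ∀ n → 0≤ -[1+ n ] → ⊥
¬0≤-[1+ n ] ()

i<j⇒0≤j-i-1 : ∀ {i j} → i < j → 0≤ j - i - 1ℤ
i<j⇒0≤j-i-1 {i} {j} i<j = 0≤-by (e i j) (i≤j⇒0≤j-i (i<j⇒suc[i]≤j i<j))
  where
  e : ∀ i j → j - (1ℤ + i) ≡ j - i - 1ℤ
  e = solve-∀

0≤j-i-1⇒i<j : ∀ {i j} → 0≤ j - i - 1ℤ → i < j
0≤j-i-1⇒i<j {i} {j} h = suc[i]≤j⇒i<j (0≤i-j⇒j≤i (0≤-by (e i j) h))
  where
  e : ∀ i j → j - i - 1ℤ ≡ j - (1ℤ + i)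
  e = solve-∀

0<i⇒0≤i-1 : ∀ {i} → 0ℤ < i → 0≤ i - 1ℤ
0<i⇒0≤i-1 {i} h = 0≤-by (e i) (i<j⇒0≤j-i-1 h)
  where
  e : ∀ i → i - 0ℤ - 1ℤ ≡ i - 1ℤ
  e = solve-∀

0≤i-1⇒0<i : ∀ {i} → 0≤ i - 1ℤ → 0ℤ < i
0≤i-1⇒0<i {i} h = 0≤j-i-1⇒i<j (0≤-by (e i) h)
  where
  e : ∀ i → i - 1ℤ ≡ i - 0ℤ - 1ℤ
  e = solve-∀

i<0⇒0≤-i-1 : ∀ {i} → i < 0ℤ → 0≤ - i - 1ℤ
i<0⇒0≤-i-1 {i} h = 0≤-by (e i) (i<j⇒0≤j-i-1 h)
  where
  e : ∀ i → 0ℤ - i - 1ℤ ≡ - i - 1ℤ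
  e = solve-∀

0≤-i-1⇒i<0 : ∀ {i} → 0≤ - i - 1ℤ → i < 0ℤ
0≤-i-1⇒i<0 {i} h = 0≤j-i-1⇒i<j (0≤-by (e i) h)
  where
  e : ∀ i → - i - 1ℤ ≡ 0ℤ - i - 1ℤ
  e = solve-∀

i<0⇒0≤-i : ∀ {i} → i < 0ℤ → 0≤ - i
i<0⇒0≤-i {i} h = 0≤-by (e i) (0≤-+ (i<0⇒0≤-i-1 h) (0≤+ 1))
  where
  e : ∀ i → - i - 1ℤ + 1ℤ ≡ - i
  e = solve-∀

0≤-square : ∀ x → 0≤ x * x
0≤-square x with 0ℤ ≤? x
... | yes 0≤x = 0≤-* 0≤x 0≤x
... | no 0≰x = 0≤-by (e x) (0≤-* 0≤-x 0≤-x)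
  where
  0≤-x : 0≤ - x
  0≤-x = i<0⇒0≤-i (≰⇒> 0≰x)
  e : ∀ x → (- x) * (- x) ≡ x * x
  e = solve-∀

square-mono : ∀ {x y} → 0≤ x → 0≤ y - x → 0≤ y * y - x * x
square-mono {x} {y} 0≤x 0≤d = 0≤-by (e x y) (0≤-* 0≤d (0≤-+ 0≤d (0≤-+ 0≤x 0≤x)))
  where
  e : ∀ x y → (y - x) * ((y - x) + (x + x)) ≡ y * y - x * x
  e = solve-∀

square-cancel-< : ∀ {x y} → 0≤ y → x * x < y * y → x < y
square-cancel-< {x} {y} 0≤y x²<y² with x <? y
... | yes x<y = x<y
... | no x≮y = ⊥-elim (<⇒≱ x²<y² (0≤i-j⇒j≤i (square-mono {y} {x} 0≤y (i≤j⇒0≤j-i (≮⇒≥ x≮y)))))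

square-cancel-≤ : ∀ {x y} → 0≤ y → x * x ≤ᶻ y * y → x ≤ᶻ y
square-cancel-≤ {x} {y} 0≤y x²≤y² with x ≤? y
... | yes x≤y = x≤y
... | no x≰y = ⊥-elim (<⇒≱ (0≤j-i-1⇒i<j (0≤-by (e x y) certificate)) x²≤y²)
  where
  d : 0≤ x - y - 1ℤ
  d = i<j⇒0≤j-i-1 (≰⇒> x≰y)
  certificate : 0≤ (x - y - 1ℤ) * (x - y - 1ℤ + 1ℤ + (y + y)) + (x - y - 1ℤ + (y + y))
  certificate = 0≤-+ (0≤-* d (0≤-+ (0≤-+ d (0≤+ 1)) (0≤-+ 0≤y 0≤y))) (0≤-+ d (0≤-+ 0≤y 0≤y))
  e : ∀ x y → (x - y - 1ℤ) * (x - y - 1ℤ + 1ℤ + (y + y)) + (x - y - 1ℤ + (y + y)) ≡ x * x - y * y - 1ℤ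
  e = solve-∀

data Pos√5 (A B : ℤ) : Set where
  pos-nn : 0≤ A → 0≤ B → 0ℤ < A + B → Pos√5 A B
  pos-pn : 0ℤ < A → B < 0ℤ → + 5 * (B * B) < A * A → Pos√5 A B
  pos-np : A < 0ℤ → 0ℤ < B → A * A < + 5 * (B * B) → Pos√5 A B

5B²<A²⇒0<A+B : ∀ {A B} → 0ℤ < A → + 5 * (B * B) < A * A → 0ℤ < A + B
5B²<A²⇒0<A+B {A} {B} 0<A 5B²<A² = 0≤i-1⇒0<i (0≤-by (e A B) (i<j⇒0≤j-i-1 -B<A))
  where
  e′ : ∀ A B → A * A - + 5 * (B * B) - 1ℤ + + 4 * (B * B) ≡ A * A - (- B) * (- B) - 1ℤ
  e′ = solve-∀
  -B<A : - B < A
  -B<A = square-cancel-< (<⇒≤ 0<A)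
    (0≤j-i-1⇒i<j (0≤-by (e′ A B) (0≤-+ (i<j⇒0≤j-i-1 5B²<A²) (0≤-* (0≤+ 4) (0≤-square B)))))
  e : ∀ A B → A - (- B) - 1ℤ ≡ A + B - 1ℤ
  e = solve-∀

A²<5B²⇒0<A+5B : ∀ {A B} → 0ℤ < B → A * A < + 5 * (B * B) → 0ℤ < A + + 5 * B
A²<5B²⇒0<A+5B {A} {B} 0<B A²<5B² = 0≤i-1⇒0<i (0≤-by (e A B) (i<j⇒0≤j-i-1 -A<5B))
  where
  e′ : ∀ A B → + 5 * (B * B) - A * A - 1ℤ + + 20 * (B * B) ≡ (+ 5 * B) * (+ 5 * B) - (- A) * (- A) - 1ℤ
  e′ = solve-∀
  -A<5B : - A < + 5 * B
  -A<5B = square-cancel-< (0≤-* (0≤+ 5) (<⇒≤ 0<B))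
    (0≤j-i-1⇒i<j (0≤-by (e′ A B) (0≤-+ (i<j⇒0≤j-i-1 A²<5B²) (0≤-* (0≤+ 20) (0≤-square B)))))
  e : ∀ A B → + 5 * B - (- A) - 1ℤ ≡ A + + 5 * B - 1ℤ
  e = solve-∀

module _ {k : ℤ} (0<k : 0ℤ < k) where
  private
    cancel-< : ∀ {i j} → k * i < k * j → i < j
    cancel-< = *-cancelˡ-<-nonNeg k ⦃ nonNegative (<⇒≤ 0<k) ⦄

    cancel-0< : ∀ {i} → 0ℤ < k * i → 0ℤ < i
    cancel-0< {i} h = cancel-< (subst (_< k * i) (sym (*-zeroʳ k)) h)

    cancel-<0 : ∀ {i} → k * i < 0ℤ → i < 0ℤ
    cancel-<0 {i} h = cancel-< (subst (k * i <_) (sym (*-zeroʳ k)) h)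

    cancel-0≤ : ∀ {i} → 0≤ k * i → 0≤ i
    cancel-0≤ {i} h = *-cancelˡ-≤-pos 0ℤ i k ⦃ positive 0<k ⦄ (subst (_≤ᶻ k * i) (sym (*-zeroʳ k)) h)

    cancel-k² : ∀ {i j} → (k * k) * i < (k * k) * j → i < j
    cancel-k² = *-cancelˡ-<-nonNeg (k * k) ⦃ nonNegative (0≤-square k) ⦄

    square-scale : ∀ i → (k * i) * (k * i) ≡ (k * k) * (i * i)
    square-scale = e k
      where
      e : ∀ k i → (k * i) * (k * i) ≡ (k * k) * (i * i)
      e = solve-∀

    5square-scale : ∀ i → + 5 * ((k * i) * (k * i)) ≡ (k * k) * (+ 5 * (i * i))
    5square-scale = e k
      where
      e : ∀ k i → + 5 * ((k * i) * (k * i)) ≡ (k * k) * (+ 5 * (i * i))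
      e = solve-∀

  Pos√5-unscale : ∀ {A B} → Pos√5 (k * A) (k * B) → Pos√5 A B
  Pos√5-unscale {A} {B} (pos-nn 0≤kA 0≤kB 0<kA+kB) =
    pos-nn (cancel-0≤ 0≤kA) (cancel-0≤ 0≤kB) (cancel-0< (0<-by (sym (*-distribˡ-+ k A B)) 0<kA+kB))
  Pos√5-unscale {A} {B} (pos-pn 0<kA kB<0 5kB²<kA²) =
    pos-pn (cancel-0< 0<kA) (cancel-<0 kB<0) (cancel-k² (subst₂ _<_ (5square-scale B) (square-scale A) 5kB²<kA²))
  Pos√5-unscale {A} {B} (pos-np kA<0 0<kB kA²<5kB²) =
    pos-np (cancel-<0 kA<0) (cancel-0< 0<kB) (cancel-k² (subst₂ _<_ (square-scale A) (5square-scale B) kA²<5kB²))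

Pos√5-*[1+√5] : ∀ {A B} → Pos√5 A B → Pos√5 (A + + 5 * B) (A + B)
Pos√5-*[1+√5] {A} {B} (pos-nn 0≤A 0≤B 0<A+B) =
  pos-nn 0≤A+5B (0≤-+ 0≤A 0≤B) (0<-by (+-comm (A + B) (A + + 5 * B)) (+-mono-<-≤ 0<A+B 0≤A+5B))
  where
  0≤A+5B : 0≤ A + + 5 * B
  0≤A+5B = 0≤-+ 0≤A (0≤-* (0≤+ 5) 0≤B)
Pos√5-*[1+√5] {A} {B} (pos-pn 0<A B<0 5B²<A²) with 0ℤ ≤? A + + 5 * B
... | yes 0≤A+5B = pos-nn 0≤A+5B (<⇒≤ (5B²<A²⇒0<A+B {A} {B} 0<A 5B²<A²)) (+-mono-≤-< 0≤A+5B (5B²<A²⇒0<A+B {A} {B} 0<A 5B²<A²))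
... | no 0≰A+5B = pos-np (≰⇒> 0≰A+5B) (5B²<A²⇒0<A+B {A} {B} 0<A 5B²<A²)
  (0≤j-i-1⇒i<j (0≤-by (e A B) (0≤-+ (0≤-* (0≤+ 4) (i<j⇒0≤j-i-1 5B²<A²)) (0≤+ 3))))
  where
  e : ∀ A B → + 4 * (A * A - + 5 * (B * B) - 1ℤ) + + 3 ≡ + 5 * ((A + B) * (A + B)) - (A + + 5 * B) * (A + + 5 * B) - 1ℤ
  e = solve-∀
Pos√5-*[1+√5] {A} {B} (pos-np A<0 0<B A²<5B²) with 0ℤ ≤? A + B
... | yes 0≤A+B = pos-nn (<⇒≤ (A²<5B²⇒0<A+5B {A} {B} 0<B A²<5B²)) 0≤A+B (+-mono-<-≤ (A²<5B²⇒0<A+5B {A} {B} 0<B A²<5B²) 0≤A+B)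
... | no 0≰A+B = pos-pn (A²<5B²⇒0<A+5B {A} {B} 0<B A²<5B²) (≰⇒> 0≰A+B)
  (0≤j-i-1⇒i<j (0≤-by (e A B) (0≤-+ (0≤-* (0≤+ 4) (i<j⇒0≤j-i-1 A²<5B²)) (0≤+ 3))))
  where
  e : ∀ A B → + 4 * (+ 5 * (B * B) - A * A - 1ℤ) + + 3 ≡ (A + + 5 * B) * (A + + 5 * B) - + 5 * ((A + B) * (A + B)) - 1ℤ
  e = solve-∀

Pos√5-+-nonNeg : ∀ {A B C D} → Pos√5 A B → 0≤ C → 0≤ D → Pos√5 (A + C) (B + D)
Pos√5-+-nonNeg {A} {B} {C} {D} (pos-nn 0≤A 0≤B 0<A+B) 0≤C 0≤D =
  pos-nn (0≤-+ 0≤A 0≤C) (0≤-+ 0≤B 0≤D) (0<-by (e A B C D) (+-mono-<-≤ 0<A+B (0≤-+ 0≤C 0≤D)))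
  where
  e : ∀ A B C D → A + B + (C + D) ≡ A + C + (B + D)
  e = solve-∀
Pos√5-+-nonNeg {A} {B} {C} {D} (pos-pn 0<A B<0 5B²<A²) 0≤C 0≤D with 0ℤ ≤? B + D
... | yes 0≤B+D = pos-nn (<⇒≤ 0<A+C) 0≤B+D (+-mono-<-≤ 0<A+C 0≤B+D)
  where
  0<A+C : 0ℤ < A + C
  0<A+C = +-mono-<-≤ 0<A 0≤C
... | no 0≰B+D = pos-pn (+-mono-<-≤ 0<A 0≤C) B+D<0
  (0≤j-i-1⇒i<j (0≤-by (e A B C D) (0≤-+ (0≤-+ A²≤[A+C]² (i<j⇒0≤j-i-1 5B²<A²)) (0≤-* (0≤+ 5) [B+D]²≤B²))))
  where
  B+D<0 : B + D < 0ℤ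
  B+D<0 = ≰⇒> 0≰B+D
  A²≤[A+C]² : 0≤ (A + C) * (A + C) - A * A
  A²≤[A+C]² = square-mono {A} {A + C} (<⇒≤ 0<A) (0≤-by (e′ A C) 0≤C)
    where
    e′ : ∀ A C → C ≡ A + C - A
    e′ = solve-∀
  [B+D]²≤B² : 0≤ (- B) * (- B) - (- (B + D)) * (- (B + D))
  [B+D]²≤B² = square-mono { - (B + D)} { - B} (i<0⇒0≤-i B+D<0) (0≤-by (e′ B D) 0≤D)
    where
    e′ : ∀ B D → D ≡ - B - (- (B + D))
    e′ = solve-∀
  e : ∀ A B C D → (A + C) * (A + C) - A * A + (A * A - + 5 * (B * B) - 1ℤ) + + 5 * ((- B) * (- B) - (- (B + D)) * (- (B + D)))
                  ≡ (A + C) * (A + C) - + 5 * ((B + D) * (B + D)) - 1ℤ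
  e = solve-∀
Pos√5-+-nonNeg {A} {B} {C} {D} (pos-np A<0 0<B A²<5B²) 0≤C 0≤D with 0ℤ ≤? A + C
... | yes 0≤A+C = pos-nn 0≤A+C (<⇒≤ 0<B+D) (+-mono-≤-< 0≤A+C 0<B+D)
  where
  0<B+D : 0ℤ < B + D
  0<B+D = +-mono-<-≤ 0<B 0≤D
... | no 0≰A+C = pos-np A+C<0 (+-mono-<-≤ 0<B 0≤D)
  (0≤j-i-1⇒i<j (0≤-by (e A B C D) (0≤-+ (0≤-+ (0≤-* (0≤+ 5) B²≤[B+D]²) (i<j⇒0≤j-i-1 A²<5B²)) [A+C]²≤A²)))
  where
  A+C<0 : A + C < 0ℤ
  A+C<0 = ≰⇒> 0≰A+C
  B²≤[B+D]² : 0≤ (B + D) * (B + D) - B * B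
  B²≤[B+D]² = square-mono {B} {B + D} (<⇒≤ 0<B) (0≤-by (e′ B D) 0≤D)
    where
    e′ : ∀ B D → D ≡ B + D - B
    e′ = solve-∀
  [A+C]²≤A² : 0≤ (- A) * (- A) - (- (A + C)) * (- (A + C))
  [A+C]²≤A² = square-mono { - (A + C)} { - A} (i<0⇒0≤-i A+C<0) (0≤-by (e′ A C) 0≤C)
    where
    e′ : ∀ A C → C ≡ - A - (- (A + C))
    e′ = solve-∀
  e : ∀ A B C D → + 5 * ((B + D) * (B + D) - B * B) + (+ 5 * (B * B) - A * A - 1ℤ) + ((- A) * (- A) - (- (A + C)) * (- (A + C)))
                  ≡ + 5 * ((B + D) * (B + D)) - (A + C) * (A + C) - 1ℤ
  e = solve-∀

Pos√5-*√5 : ∀ {A B} → Pos√5 A B → Pos√5 (+ 5 * B) A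
Pos√5-*√5 {A} {B} (pos-nn 0≤A 0≤B 0<A+B) =
  pos-nn (0≤-* (0≤+ 5) 0≤B) 0≤A (0<-by (e A B) (+-mono-<-≤ 0<A+B (0≤-* (0≤+ 4) 0≤B)))
  where
  e : ∀ A B → A + B + + 4 * B ≡ + 5 * B + A
  e = solve-∀
Pos√5-*√5 {A} {B} (pos-pn 0<A B<0 5B²<A²) =
  pos-np (0≤-i-1⇒i<0 (0≤-by (e B) (0≤-+ (0≤-* (0≤+ 5) (i<0⇒0≤-i-1 B<0)) (0≤+ 4)))) 0<A
    (0≤j-i-1⇒i<j (0≤-by (e′ A B) (0≤-+ (0≤-* (0≤+ 5) (i<j⇒0≤j-i-1 5B²<A²)) (0≤+ 4))))
  where
  e : ∀ B → + 5 * (- B - 1ℤ) + + 4 ≡ - (+ 5 * B) - 1ℤ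
  e = solve-∀
  e′ : ∀ A B → + 5 * (A * A - + 5 * (B * B) - 1ℤ) + + 4 ≡ + 5 * (A * A) - (+ 5 * B) * (+ 5 * B) - 1ℤ
  e′ = solve-∀
Pos√5-*√5 {A} {B} (pos-np A<0 0<B A²<5B²) =
  pos-pn (*-monoˡ-<-pos (+ 5) 0<B) A<0
    (0≤j-i-1⇒i<j (0≤-by (e A B) (0≤-+ (0≤-* (0≤+ 5) (i<j⇒0≤j-i-1 A²<5B²)) (0≤+ 4))))
  where
  e : ∀ A B → + 5 * (+ 5 * (B * B) - A * A - 1ℤ) + + 4 ≡ (+ 5 * B) * (+ 5 * B) - + 5 * (A * A) - 1ℤ
  e = solve-∀

Pos√5-/√5 : ∀ {A B} → Pos√5 (+ 5 * B) A → Pos√5 A B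
Pos√5-/√5 h = Pos√5-unscale {+ 5} (ℤ.+<+ (s≤s z≤n)) (Pos√5-*√5 h)

-- Otherwise A − 1 ≤ 3 (−B − 1), as 5 < 3², which is too small for 5B² < A².
5B²<A²⇒5[B+1]²<[A-1]² : ∀ {A B} → 0ℤ < A → B + 1ℤ < 0ℤ → + 5 * (B * B) < A * A →
  + 5 * ((B + 1ℤ) * (B + 1ℤ)) < (A - 1ℤ) * (A - 1ℤ)
5B²<A²⇒5[B+1]²<[A-1]² {A} {B} 0<A B+1<0 5B²<A² with + 5 * ((B + 1ℤ) * (B + 1ℤ)) <? (A - 1ℤ) * (A - 1ℤ)
... | yes lt = lt
... | no ≮ = ⊥-elim (¬0≤-[1+ 4 ] (0≤-by (e A B)
  (0≤-+ (0≤-+ (0≤-+ (i<j⇒0≤j-i-1 5B²<A²) [A-1]²≤5[B+1]²) (0≤-* (0≤+ 2) (i≤j⇒0≤j-i A-1≤3[-B-1]))) (0≤-* (0≤+ 4) 0≤-B-1))))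
  where
  0≤-B-2 : 0≤ - (B + 1ℤ) - 1ℤ
  0≤-B-2 = i<0⇒0≤-i-1 B+1<0
  0≤-B-1 : 0≤ - B - 1ℤ
  0≤-B-1 = 0≤-by (e₁ B) (0≤-+ 0≤-B-2 (0≤+ 1))
    where
    e₁ : ∀ B → - (B + 1ℤ) - 1ℤ + 1ℤ ≡ - B - 1ℤ
    e₁ = solve-∀
  [A-1]²≤5[B+1]² : 0≤ + 5 * ((B + 1ℤ) * (B + 1ℤ)) - (A - 1ℤ) * (A - 1ℤ)
  [A-1]²≤5[B+1]² = i≤j⇒0≤j-i (≮⇒≥ ≮)
  A-1≤3[-B-1] : A - 1ℤ ≤ᶻ + 3 * (- B - 1ℤ)
  A-1≤3[-B-1] = square-cancel-≤ (0≤-* (0≤+ 3) 0≤-B-1)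
    (0≤i-j⇒j≤i (0≤-by (e₂ A B) (0≤-+ [A-1]²≤5[B+1]² (0≤-* (0≤+ 4) (0≤-square (B + 1ℤ))))))
    where
    e₂ : ∀ A B → + 5 * ((B + 1ℤ) * (B + 1ℤ)) - (A - 1ℤ) * (A - 1ℤ) + + 4 * ((B + 1ℤ) * (B + 1ℤ))
                 ≡ (+ 3 * (- B - 1ℤ)) * (+ 3 * (- B - 1ℤ)) - (A - 1ℤ) * (A - 1ℤ)
    e₂ = solve-∀
  e : ∀ A B → A * A - + 5 * (B * B) - 1ℤ + (+ 5 * ((B + 1ℤ) * (B + 1ℤ)) - (A - 1ℤ) * (A - 1ℤ))
              + + 2 * (+ 3 * (- B - 1ℤ) - (A - 1ℤ)) + + 4 * (- B - 1ℤ) ≡ -[1+ 4 ]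
  e = solve-∀

Pos√5-+[√5-1] : ∀ {A B} → Pos√5 A B → Pos√5 (A - 1ℤ) (B + 1ℤ)
Pos√5-+[√5-1] {A} {B} (pos-nn 0≤A 0≤B 0<A+B) with 0ℤ ≤? A - 1ℤ
... | yes 0≤A-1 = pos-nn 0≤A-1 (0≤-+ 0≤B (0≤+ 1)) (0<-by (e A B) 0<A+B)
  where
  e : ∀ A B → A + B ≡ A - 1ℤ + (B + 1ℤ)
  e = solve-∀
... | no 0≰A-1 = pos-np (≰⇒> 0≰A-1) (+-mono-≤-< 0≤B 0<1)
  (0≤j-i-1⇒i<j (0≤-by (e A B) (0≤-+ (0≤-+ (0≤-+ (0≤-* (0≤+ 5) (0≤-square B)) (0≤-* (0≤+ 10) 0≤B)) (0≤+ 3))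
                                    (0≤-+ (0≤-* 0≤A 0≤-A) (0≤-* (0≤+ 2) 0≤A)))))
  where
  0≤-A : 0≤ - A
  0≤-A = 0≤-by (e′ A) (i<0⇒0≤-i-1 (≰⇒> 0≰A-1))
    where
    e′ : ∀ A → - (A - 1ℤ) - 1ℤ ≡ - A
    e′ = solve-∀
  e : ∀ A B → + 5 * (B * B) + + 10 * B + + 3 + (A * (- A) + + 2 * A) ≡ + 5 * ((B + 1ℤ) * (B + 1ℤ)) - (A - 1ℤ) * (A - 1ℤ) - 1ℤ
  e = solve-∀
Pos√5-+[√5-1] {A} {B} (pos-pn 0<A B<0 5B²<A²) with 0ℤ ≤? B + 1ℤ
... | yes 0≤B+1 = pos-nn (0<i⇒0≤i-1 0<A) 0≤B+1 (0<-by (e A B) (5B²<A²⇒0<A+B {A} {B} 0<A 5B²<A²))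
  where
  e : ∀ A B → A + B ≡ A - 1ℤ + (B + 1ℤ)
  e = solve-∀
... | no 0≰B+1 = pos-pn 0<A-1 B+1<0 (5B²<A²⇒5[B+1]²<[A-1]² {A} {B} 0<A B+1<0 5B²<A²)
  where
  B+1<0 : B + 1ℤ < 0ℤ
  B+1<0 = ≰⇒> 0≰B+1
  0<A-1 : 0ℤ < A - 1ℤ
  0<A-1 = 0≤i-1⇒0<i (0≤-by (e A B)
    (0≤-+ (0≤-+ (0<i⇒0≤i-1 (5B²<A²⇒0<A+B {A} {B} 0<A 5B²<A²)) (i<0⇒0≤-i-1 B+1<0)) (0≤+ 1)))
    where
    e : ∀ A B → A + B - 1ℤ + (- (B + 1ℤ) - 1ℤ) + 1ℤ ≡ A - 1ℤ - 1ℤ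
    e = solve-∀
Pos√5-+[√5-1] {A} {B} (pos-np A<0 0<B A²<5B²) =
  pos-np (0≤-i-1⇒i<0 (0≤-by (e A) (0≤-+ (i<0⇒0≤-i-1 A<0) (0≤+ 1)))) (+-mono-<-≤ 0<B (0≤+ 1))
    (0≤j-i-1⇒i<j (0≤-by (e′ A B)
      (0≤-+ (0≤-+ (i<j⇒0≤j-i-1 A²<5B²) (0≤-* (0≤+ 2) (0<i⇒0≤i-1 (A²<5B²⇒0<A+5B {A} {B} 0<B A²<5B²)))) (0≤+ 6))))
  where
  e : ∀ A → - A - 1ℤ + 1ℤ ≡ - (A - 1ℤ) - 1ℤ
  e = solve-∀
  e′ : ∀ A B → + 5 * (B * B) - A * A - 1ℤ + + 2 * (A + + 5 * B - 1ℤ) + + 6 ≡ + 5 * ((B + 1ℤ) * (B + 1ℤ)) - (A - 1ℤ) * (A - 1ℤ) - 1ℤ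
  e′ = solve-∀

-- The pair (a , b) stands for a + bφ.  Multiplication by φ maps it to b + (a + b)φ, which is also
-- the step (w_k , w_{k+1}) ↦ (w_{k+1} , w_{k+2}) of a Fibonacci walk.
ℤ[φ] : Set
ℤ[φ] = ℤ × ℤ

infixr 8 φ·_ φ^_·_

φ·_ : ℤ[φ] → ℤ[φ]
φ· (a , b) = (b , a + b)

φ^_·_ : ℕ → ℤ[φ] → ℤ[φ]
φ^ zero · x = x
φ^ suc j · x = φ· (φ^ j · x)

-- F_{j−1} + F_j φ
φ^[_] : ℕ → ℤ[φ]
φ^[ j ] = φ^ j · (1ℤ , 0ℤ)

φ⁻¹ : ℤ[φ]
φ⁻¹ = (-1ℤ , 1ℤ)

_⊕_ _⊖_ : ℤ[φ] → ℤ[φ] → ℤ[φ]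
(a , b) ⊕ (c , d) = (a + c , b + d)
(a , b) ⊖ (c , d) = (a - c , b - d)

norm : ℤ[φ] → ℤ
norm (a , b) = a * a + a * b - b * b

-- 2 (a + bφ) = (2a + b) + b√5
Posφ : ℤ[φ] → Set
Posφ (a , b) = Pos√5 (a + a + b) b

φ^-comm : ∀ j x → φ^ j · φ· x ≡ φ· φ^ j · x
φ^-comm zero x = refl
φ^-comm (suc j) x = cong φ·_ (φ^-comm j x)

φ^-+ : ∀ i j x → φ^ (i ℕ.+ j) · x ≡ φ^ i · φ^ j · x
φ^-+ zero j x = refl
φ^-+ (suc i) j x = cong φ·_ (φ^-+ i j x)

φ^-linear : ∀ j x y → φ^ j · (x , y) ≡
  (x * proj₁ φ^[ j ] + y * proj₂ φ^[ j ] , x * proj₂ φ^[ j ] + y * (proj₁ φ^[ j ] + proj₂ φ^[ j ]))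
φ^-linear zero x y = cong₂ _,_ (e x y) (e′ x y)
  where
  e : ∀ x y → x ≡ x * 1ℤ + y * 0ℤ
  e = solve-∀
  e′ : ∀ x y → y ≡ x * 0ℤ + y * (1ℤ + 0ℤ)
  e′ = solve-∀
φ^-linear (suc j) x y =
  trans (cong φ·_ (φ^-linear j x y)) (cong₂ _,_ refl (e x y (proj₁ φ^[ j ]) (proj₂ φ^[ j ])))
  where
  e : ∀ x y a b → x * a + y * b + (x * b + y * (a + b)) ≡ x * (a + b) + y * (b + (a + b))
  e = solve-∀

norm-φ· : ∀ x → norm (φ· x) ≡ - norm x
norm-φ· (a , b) = e a b
  where
  e : ∀ a b → b * b + b * (a + b) - (a + b) * (a + b) ≡ - (a * a + a * b - b * b)
  e = solve-∀

norm-φ^[_] : ∀ j → norm φ^[ j ] ≡ 1ℤ ⊎ norm φ^[ j ] ≡ -1ℤ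
norm-φ^[ zero ] = inj₁ refl
norm-φ^[ suc j ] with norm-φ^[ j ]
... | inj₁ N≡1 = inj₂ (trans (norm-φ· φ^[ j ]) (cong -_ N≡1))
... | inj₂ N≡-1 = inj₁ (trans (norm-φ· φ^[ j ]) (cong -_ N≡-1))

φ^[_]-bounds : ∀ j → 0≤ proj₁ φ^[ j ] × 0≤ proj₂ φ^[ j ] × 0ℤ < proj₁ φ^[ j ] + proj₂ φ^[ j ]
φ^[ zero ]-bounds = 0≤+ 1 , 0≤+ 0 , 0<1
φ^[ suc j ]-bounds with φ^[ j ]-bounds
... | _ , 0≤b , 0<a+b = 0≤b , <⇒≤ 0<a+b , +-mono-≤-< 0≤b 0<a+b

Posφ-φ· : ∀ x → Posφ x → Posφ (φ· x)
Posφ-φ· (a , b) h = Pos√5-unscale {+ 2} (ℤ.+<+ (s≤s z≤n)) (subst₂ Pos√5 (e a b) (e′ a b) (Pos√5-*[1+√5] h))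
  where
  e : ∀ a b → a + a + b + + 5 * b ≡ + 2 * (b + b + (a + b))
  e = solve-∀
  e′ : ∀ a b → a + a + b + b ≡ + 2 * (a + b)
  e′ = solve-∀

¬Posφ-negative : ∀ {a b} → a < 0ℤ → b ≤ᶻ 0ℤ → Posφ (a , b) → ⊥
¬Posφ-negative a<0 b≤0 (pos-nn 0≤2a+b _ _) = <⇒≱ (+-mono-<-≤ (+-mono-< a<0 a<0) b≤0) 0≤2a+b
¬Posφ-negative a<0 b≤0 (pos-pn 0<2a+b _ _) = <-asym (+-mono-<-≤ (+-mono-< a<0 a<0) b≤0) 0<2a+b
¬Posφ-negative a<0 b≤0 (pos-np _ 0<b _) = <⇒≱ 0<b b≤0

-- √5 (y − φx) in the basis 1, φ, using √5 = 2φ − 1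
√5·err : ℤ × ℤ → ℤ[φ]
√5·err (x , y) = (- y - (x + x) , y + y - x)

Approx : ℤ × ℤ → ℤ[φ] → Set
Approx p t = Posφ (t ⊖ √5·err p) × Posφ (t ⊕ √5·err p)

-- The error of φ·p is −φ⁻¹ times the error of p, so the two one-sided bounds swap.
approx-step : ∀ p t → Approx (φ· p) t → Approx p (φ· t)
approx-step (x , y) (a , b) (above , below) =
  subst Posφ (cong₂ _,_ (e x y b) (e′ x y a b)) (Posφ-φ· ((a , b) ⊕ √5·err (φ· (x , y))) below) ,
  subst Posφ (cong₂ _,_ (f x y b) (f′ x y a b)) (Posφ-φ· ((a , b) ⊖ √5·err (φ· (x , y))) above)
  where
  e : ∀ x y b → b + ((x + y) + (x + y) - y) ≡ b - (- y - (x + x))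
  e = solve-∀
  e′ : ∀ x y a b → a + (- (x + y) - (y + y)) + (b + ((x + y) + (x + y) - y)) ≡ a + b - (y + y - x)
  e′ = solve-∀
  f : ∀ x y b → b - ((x + y) + (x + y) - y) ≡ b + (- y - (x + x))
  f = solve-∀
  f′ : ∀ x y a b → a - (- (x + y) - (y + y)) + (b - ((x + y) + (x + y) - y)) ≡ a + b + (y + y - x)
  f′ = solve-∀

approx-iterate : ∀ j p t → Approx (φ^ j · p) t → Approx p (φ^ j · t)
approx-iterate zero p t h = h
approx-iterate (suc j) p t h =
  subst (Approx p) (φ^-comm j t) (approx-iterate j p (φ· t) (approx-step (φ^ j · p) t h))

norm±1⇒divides : ∀ {u v G H} → norm (G , H) ≡ 1ℤ ⊎ norm (G , H) ≡ -1ℤ → u * G ≡ v * H →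
  ∃ λ q → v ≡ G * q
norm±1⇒divides {u} {v} {G} {H} N≡±1 uG≡vH = divides N≡±1
  where
  z : ℤ
  z = v * G + v * H - u * H
  -- v N(G, H) = G z + H (uG − vH): a Bézout identity for G and H.
  vN≡Gz : v * norm (G , H) ≡ G * z
  vN≡Gz = begin
    v * norm (G , H)             ≡⟨ e u v G H ⟩
    G * z + H * (u * G - v * H)  ≡⟨ cong (λ t → G * z + H * (t - v * H)) uG≡vH ⟩
    G * z + H * (v * H - v * H)  ≡⟨ e′ (G * z) H (v * H) ⟩
    G * z                        ∎
    where
    e : ∀ u v G H → v * (G * G + G * H - H * H) ≡ G * (v * G + v * H - u * H) + H * (u * G - v * H)
    e = solve-∀
    e′ : ∀ a H b → a + H * (b - b) ≡ a
    e′ = solve-∀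
  divides : norm (G , H) ≡ 1ℤ ⊎ norm (G , H) ≡ -1ℤ → ∃ λ q → v ≡ G * q
  divides (inj₁ N≡1) = z , (begin
    v                 ≡⟨ sym (*-identityʳ v) ⟩
    v * 1ℤ            ≡⟨ cong (v *_) (sym N≡1) ⟩
    v * norm (G , H)  ≡⟨ vN≡Gz ⟩
    G * z             ∎)
  divides (inj₂ N≡-1) = - z , (begin
    v                     ≡⟨ e v ⟩
    - (v * -1ℤ)           ≡⟨ cong (λ t → - (v * t)) (sym N≡-1) ⟩
    - (v * norm (G , H))  ≡⟨ cong -_ vN≡Gz ⟩
    - (G * z)             ≡⟨ neg-distribʳ-* G z ⟩
    G * - z               ∎)
    where
    e : ∀ v → v ≡ - (v * -1ℤ)
    e = solve-∀

divisor≤multiple : ∀ {u v G H q} → 0ℤ < u → 0≤ G → 0ℤ < H → u * G ≡ v * H → v ≡ G * q → G ≤ᶻ v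
divisor≤multiple {u} {v} {G} {H} {q} 0<u 0≤G 0<H uG≡vH v≡Gq with 0ℤ <? G
... | no 0≮G = subst₂ _≤ᶻ_ (sym G≡0) (sym v≡0) ≤-refl
  where
  G≡0 : G ≡ 0ℤ
  G≡0 = ≤-antisym (≮⇒≥ 0≮G) 0≤G
  v≡0 : v ≡ 0ℤ
  v≡0 = trans v≡Gq (trans (cong (_* q) G≡0) (*-zeroˡ q))
... | yes 0<G = subst (G ≤ᶻ_) (sym v≡Gq) (subst (_≤ᶻ G * q) (*-identityʳ G) (*-monoˡ-≤-nonNeg G ⦃ nonNegative 0≤G ⦄ 1≤q))
  where
  0<v : 0ℤ < v
  0<v = *-cancelʳ-<-nonNeg {0ℤ} {v} H ⦃ nonNegative (<⇒≤ 0<H) ⦄ (subst (0ℤ <_) uG≡vH (*-monoʳ-<-pos G ⦃ positive 0<G ⦄ 0<u))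
  1≤q : 1ℤ ≤ᶻ q
  1≤q = i<j⇒suc[i]≤j (*-cancelˡ-<-nonNeg {0ℤ} {q} G ⦃ nonNegative 0≤G ⦄ (subst₂ _<_ (sym (*-zeroʳ G)) v≡Gq 0<v))

norm±1⇒norm≤1 : ∀ {x} → norm x ≡ 1ℤ ⊎ norm x ≡ -1ℤ → 0≤ 1ℤ - norm x
norm±1⇒norm≤1 (inj₁ N≡1) = 0≤-by (cong (λ N → 1ℤ - N) (sym N≡1)) (0≤+ 0)
norm±1⇒norm≤1 (inj₂ N≡-1) = 0≤-by (cong (λ N → 1ℤ - N) (sym N≡-1)) (0≤+ 2)

-- a + bφ > √5 (β − φα) ≥ √5 β, as α ≤ 0
above-√5·err⇒above-√5β : ∀ {a b α β} → 0≤ - α → Posφ ((a , b) ⊖ √5·err (α , β)) → Pos√5 (a + a + b) (b - β - β)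
above-√5·err⇒above-√5β {a} {b} {α} {β} 0≤-α h = subst₂ Pos√5 (e a b α β) (e′ b α β) (Pos√5-+-nonNeg h (0≤-* (0≤+ 5) 0≤-α) 0≤-α)
  where
  e : ∀ a b α β → a - (- β - (α + α)) + (a - (- β - (α + α))) + (b - (β + β - α)) + + 5 * (- α) ≡ a + a + b
  e = solve-∀
  e′ : ∀ b α β → b - (β + β - α) + - α ≡ b - β - β
  e′ = solve-∀

-- If a unit a + bφ is at least 1, its conjugate a + bφ − √5 b has absolute value at most 1,
-- so a + bφ ≤ √5 b + 1 < √5 β.
¬unit>√5β : ∀ {a b β} → norm (a , b) ≡ 1ℤ ⊎ norm (a , b) ≡ -1ℤ → 0≤ b → b < β → Pos√5 (a + a + b) (b - β - β) → ⊥
¬unit>√5β {a} {b} {β} N≡±1 0≤b b<β (pos-nn _ 0≤b-2β _) =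
  ¬0≤-[1+ 1 ] (0≤-by (e b β) (0≤-+ (0≤-+ 0≤b-2β (0≤-* (0≤+ 2) (i<j⇒0≤j-i-1 b<β))) 0≤b))
  where
  e : ∀ b β → b - β - β + + 2 * (β - b - 1ℤ) + b ≡ -[1+ 1 ]
  e = solve-∀
¬unit>√5β {a} {b} {β} N≡±1 0≤b b<β (pos-np _ 0<b-2β _) =
  ¬0≤-[1+ 2 ] (0≤-by (e b β) (0≤-+ (0≤-+ (0<i⇒0≤i-1 0<b-2β) (0≤-* (0≤+ 2) (i<j⇒0≤j-i-1 b<β))) 0≤b))
  where
  e : ∀ b β → b - β - β - 1ℤ + + 2 * (β - b - 1ℤ) + b ≡ -[1+ 2 ]
  e = solve-∀
¬unit>√5β {a} {b} {β} N≡±1 0≤b b<β (pos-pn _ _ 5[b-2β]²<[2a+b]²) =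
  ¬0≤-[1+ 16 ] (0≤-by (e a b β)
    (0≤-+ (0≤-+ (0≤-+ (i<j⇒0≤j-i-1 5[b-2β]²<[2a+b]²) (0≤-* (0≤+ 5) [b+2]²≤[2β-b]²)) (0≤-* (0≤+ 4) N≤1)) (0≤-* (0≤+ 20) 0≤b)))
  where
  [b+2]²≤[2β-b]² : 0≤ (- (b - β - β)) * (- (b - β - β)) - (b + + 2) * (b + + 2)
  [b+2]²≤[2β-b]² = square-mono {b + + 2} { - (b - β - β)} (0≤-+ 0≤b (0≤+ 2)) (0≤-by (e′ b β) (0≤-* (0≤+ 2) (i<j⇒0≤j-i-1 b<β)))
    where
    e′ : ∀ b β → + 2 * (β - b - 1ℤ) ≡ - (b - β - β) - (b + + 2)
    e′ = solve-∀
  N≤1 : 0≤ 1ℤ - norm (a , b)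
  N≤1 = norm±1⇒norm≤1 {a , b} N≡±1
  e : ∀ a b β → (a + a + b) * (a + a + b) - + 5 * ((b - β - β) * (b - β - β)) - 1ℤ
        + + 5 * ((- (b - β - β)) * (- (b - β - β)) - (b + + 2) * (b + + 2))
        + + 4 * (1ℤ - (a * a + a * b - b * b)) + + 20 * b ≡ -[1+ 16 ]
  e = solve-∀

no-other-start : ∀ j {α β c₁ c₂} → 0≤ - α → 0ℤ < c₁ → 0ℤ < c₂ → Posφ (φ^[ j ] ⊖ √5·err (α , β)) →
  proj₁ (φ^ suc j · (c₁ , c₂)) ≡ proj₁ (φ^ suc j · (α , β)) → ⊥
no-other-start j {α} {β} {c₁} {c₂} 0≤-α 0<c₁ 0<c₂ above same-value =
  ¬unit>√5β {proj₁ φ^[ j ]} {proj₂ φ^[ j ]} norm-φ^[ j ] (proj₁ (proj₂ φ^[ j ]-bounds)) G<β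
    (above-√5·err⇒above-√5β {proj₁ φ^[ j ]} {proj₂ φ^[ j ]} 0≤-α above)
  where
  G H : ℤ
  G = proj₁ φ^[ suc j ]
  H = proj₂ φ^[ suc j ]
  linear : c₁ * G + c₂ * H ≡ α * G + β * H
  linear = trans (sym (cong proj₁ (φ^-linear (suc j) c₁ c₂))) (trans same-value (cong proj₁ (φ^-linear (suc j) α β)))
  uG≡vH : (c₁ - α) * G ≡ (β - c₂) * H
  uG≡vH = begin
    (c₁ - α) * G                        ≡⟨ e c₁ c₂ α G H ⟩
    c₁ * G + c₂ * H - α * G - c₂ * H    ≡⟨ cong (λ t → t - α * G - c₂ * H) linear ⟩
    α * G + β * H - α * G - c₂ * H      ≡⟨ e′ c₂ α β G H ⟩
    (β - c₂) * H                        ∎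
    where
    e : ∀ c₁ c₂ α G H → (c₁ - α) * G ≡ c₁ * G + c₂ * H - α * G - c₂ * H
    e = solve-∀
    e′ : ∀ c₂ α β G H → α * G + β * H - α * G - c₂ * H ≡ (β - c₂) * H
    e′ = solve-∀
  G≤β-c₂ : G ≤ᶻ β - c₂
  G≤β-c₂ = divisor≤multiple {c₁ - α} {β - c₂} {G} {H}
    (+-mono-<-≤ 0<c₁ 0≤-α) (proj₁ φ^[ suc j ]-bounds) (proj₂ (proj₂ φ^[ j ]-bounds)) uG≡vH
    (proj₂ (norm±1⇒divides {c₁ - α} {β - c₂} {G} {H} norm-φ^[ suc j ] uG≡vH))
  G<β : G < β
  G<β = 0≤j-i-1⇒i<j (0≤-by (e G β c₂) (0≤-+ (i≤j⇒0≤j-i G≤β-c₂) (0<i⇒0≤i-1 0<c₂)))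
    where
    e : ∀ G β c₂ → β - c₂ - G + (c₂ - 1ℤ) ≡ β - G - 1ℤ
    e = solve-∀

w-φ^ : ∀ k a₁ a₂ → φ^ k · (+ a₁ , + a₂) ≡ (+ w a₁ a₂ (suc k) , + w a₁ a₂ (suc (suc k)))
w-φ^ zero a₁ a₂ = refl
w-φ^ (suc k) a₁ a₂ = trans (cong φ·_ (w-φ^ k a₁ a₂))
  (cong₂ _,_ refl (trans (sym (pos-+ (w a₁ a₂ (suc k)) _)) (cong +_ (ℕₚ.+-comm (w a₁ a₂ (suc k)) _))))

w-positive : ∀ {a₁ a₂} k → 1 ≤ a₁ → 1 ≤ a₂ → 1 ≤ w a₁ a₂ (suc k)
w-positive zero 1≤a₁ 1≤a₂ = 1≤a₁
w-positive (suc zero) 1≤a₁ 1≤a₂ = 1≤a₂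
w-positive (suc (suc k)) 1≤a₁ 1≤a₂ = ℕₚ.≤-trans (w-positive (suc k) 1≤a₁ 1≤a₂) (ℕₚ.m≤m+n _ _)

record WalkThrough (x y : ℕ) : Set where
  field
    a₁ a₂ s : ℕ
    1≤a₂ : 1 ≤ a₂
    a₂≤a₁ : a₂ ≤ a₁
    w-s≡x : w a₁ a₂ (suc s) ≡ x
    w-s+1≡y : w a₁ a₂ (suc (suc s)) ≡ y

walkThrough : ∀ fuel {x y} → y ≤ fuel → 1 ≤ x → 1 ≤ y → WalkThrough x y
walkThrough fuel {x} {y} y≤fuel 1≤x 1≤y with y ℕ.≤? x
... | yes y≤x = record { a₁ = x ; a₂ = y ; s = 0 ; 1≤a₂ = 1≤y ; a₂≤a₁ = y≤x ; w-s≡x = refl ; w-s+1≡y = refl }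
walkThrough zero {x} {y} y≤0 1≤x 1≤y | no _ = ⊥-elim (ℕₚ.<⇒≱ 1≤y y≤0)
walkThrough (suc fuel) {x} {y} y≤1+fuel 1≤x 1≤y | no y≰x =
  extend (walkThrough fuel (ℕₚ.≤-pred (ℕₚ.<-≤-trans x<y y≤1+fuel)) (ℕₚ.m<n⇒0<n∸m x<y) 1≤x)
  where
  x<y : x ℕ.< y
  x<y = ℕₚ.≰⇒> y≰x
  extend : WalkThrough (y ℕ.∸ x) x → WalkThrough x y
  extend W = record
    { a₁ = a₁ ; a₂ = a₂ ; s = suc s ; 1≤a₂ = 1≤a₂ ; a₂≤a₁ = a₂≤a₁ ; w-s≡x = w-s+1≡y
    ; w-s+1≡y = trans (cong₂ ℕ._+_ w-s+1≡y w-s≡x) (ℕₚ.m+[n∸m]≡n (ℕₚ.<⇒≤ x<y)) }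
    where open WalkThrough W

module _ {n m : ℕ} (W : WalkThrough n m) (approx : Approx (+ n , + m) φ⁻¹) where
  open WalkThrough W

  private
    -- the walk extended one step backwards: w₀ = a₂ − a₁ ≤ 0
    start : ℤ × ℤ
    start = (+ a₂ - + a₁ , + a₁)

    φ^·start : φ^ suc s · start ≡ (+ n , + m)
    φ^·start = begin
      φ^ suc s · start                                   ≡⟨ sym (φ^-comm s start) ⟩
      φ^ s · φ· start                                    ≡⟨ cong (λ a → φ^ s · (+ a₁ , a)) (e (+ a₁) (+ a₂)) ⟩
      φ^ s · (+ a₁ , + a₂)                               ≡⟨ w-φ^ s a₁ a₂ ⟩
      (+ w a₁ a₂ (suc s) , + w a₁ a₂ (suc (suc s)))     ≡⟨ cong₂ (λ p q → (+ p , + q)) w-s≡x w-s+1≡y ⟩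
      (+ n , + m)                                        ∎
      where
      e : ∀ a₁ a₂ → a₂ - a₁ + a₁ ≡ a₂
      e = solve-∀

    start-approx : Posφ (φ^[ s ] ⊖ √5·err start)
    start-approx = proj₁ (subst (Approx start) (sym (φ^-comm s φ⁻¹))
      (approx-iterate (suc s) start φ⁻¹ (subst (λ p → Approx p φ⁻¹) (sym φ^·start) approx)))

    0≤-w₀ : 0≤ - (+ a₂ - + a₁)
    0≤-w₀ = 0≤-by (e (+ a₁) (+ a₂)) (i≤j⇒0≤j-i (+≤+ a₂≤a₁))
      where
      e : ∀ a₁ a₂ → a₁ - a₂ ≡ - (a₂ - a₁)
      e = solve-∀

    maximal : ∀ b₁ b₂ t → 1 ≤ b₁ → 1 ≤ b₂ → 1 ≤ t → w b₁ b₂ t ≡ n → t ≤ suc s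
    maximal b₁ b₂ t 1≤b₁ 1≤b₂ 1≤t wt≡n with t ℕ.≤? suc s
    ... | yes t≤1+s = t≤1+s
    maximal b₁ b₂ (suc t) 1≤b₁ 1≤b₂ 1≤t wt≡n | no t≰1+s =
      ⊥-elim (no-other-start s {c₁ = proj₁ c} {c₂ = proj₂ c} 0≤-w₀ 0<c₁ 0<c₂ start-approx (begin
        proj₁ (φ^ suc s · φ^ d · (+ b₁ , + b₂))   ≡⟨ cong proj₁ (sym (φ^-+ (suc s) d (+ b₁ , + b₂))) ⟩
        proj₁ (φ^ (suc s ℕ.+ d) · (+ b₁ , + b₂))  ≡⟨ cong (λ k → proj₁ (φ^ k · (+ b₁ , + b₂))) (ℕₚ.m+[n∸m]≡n 1+s≤t) ⟩
        proj₁ (φ^ t · (+ b₁ , + b₂))              ≡⟨ cong proj₁ (w-φ^ t b₁ b₂) ⟩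
        + w b₁ b₂ (suc t)                          ≡⟨ cong +_ wt≡n ⟩
        + n                                        ≡⟨ cong proj₁ (sym φ^·start) ⟩
        proj₁ (φ^ suc s · start)                   ∎))
      where
      1+s≤t : suc s ≤ t
      1+s≤t = ℕₚ.≤-pred (ℕₚ.≰⇒> t≰1+s)
      d : ℕ
      d = t ℕ.∸ suc s
      c : ℤ × ℤ
      c = φ^ d · (+ b₁ , + b₂)
      0<c₁ : 0ℤ < proj₁ c
      0<c₁ = subst (λ p → 0ℤ < proj₁ p) (sym (w-φ^ d b₁ b₂)) (ℤ.+<+ (w-positive d 1≤b₁ 1≤b₂))
      0<c₂ : 0ℤ < proj₂ c
      0<c₂ = subst (λ p → 0ℤ < proj₂ p) (sym (w-φ^ d b₁ b₂)) (ℤ.+<+ (w-positive (suc d) 1≤b₁ 1≤b₂))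

  walkThrough-slow : Slow n a₁ a₂ (suc s)
  walkThrough-slow = ℕₚ.≤-trans 1≤a₂ a₂≤a₁ , 1≤a₂ , s≤s z≤n , w-s≡x , maximal

approx⇒1≤m : ∀ {n m} → 1 ≤ n → Approx (+ n , + m) φ⁻¹ → 1 ≤ m
approx⇒1≤m {n} {suc m} _ _ = s≤s z≤n
approx⇒1≤m {n} {zero} 1≤n (_ , below) = ⊥-elim (¬Posφ-negative a<0 b≤0 below)
  where
  a<0 : -1ℤ + (- 0ℤ - (+ n + + n)) < 0ℤ
  a<0 = 0≤-i-1⇒i<0 (0≤-by (e (+ n)) (0≤-+ (0≤+ n) (0≤+ n)))
    where
    e : ∀ n → n + n ≡ - (-1ℤ + (- 0ℤ - (n + n))) - 1ℤ
    e = solve-∀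
  b≤0 : 1ℤ + (0ℤ + 0ℤ - + n) ≤ᶻ 0ℤ
  b≤0 = 0≤i-j⇒j≤i (0≤-by (e (+ n)) (i≤j⇒0≤j-i (+≤+ 1≤n)))
    where
    e : ∀ n → n - 1ℤ ≡ 0ℤ - (1ℤ + (0ℤ + 0ℤ - n))
    e = solve-∀

ℚ-ring : ACR.AlmostCommutativeRing 0ℓ 0ℓ
ℚ-ring = ACR.fromCommutativeRing ℚₚ.+-*-commutativeRing (λ q → dec⇒maybe (0ℚ ℚₚ.≟ q))

-- i / 1, but with numerator definitionally i
fromℤ : ℤ → ℚ
fromℤ i = mkℚ i 0 (Coprime.sym (Coprime.1-coprimeTo ℤ.∣ i ∣))

fromℤ-unique : ∀ p i → ℚ.↥ p ≡ i → ℚ.↧ p ≡ 1ℤ → p ≡ fromℤ i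
fromℤ-unique (mkℚ _ zero _) _ refl refl = refl

/1≡fromℤ : ∀ i → i / 1 ≡ fromℤ i
/1≡fromℤ i = fromℤ-unique (i / 1) i (cancel-gcd (ℚₚ.↥-/ i 1)) (cancel-gcd (ℚₚ.↧-/ i 1))
  where
  cancel-gcd : ∀ {a b} → a * gcd i 1ℤ ≡ b → a ≡ b
  cancel-gcd {a} eq = trans (sym (*-identityʳ a)) (trans (cong (a *_) (sym (gcd-zeroʳ i))) eq)

fromℤ-+ : ∀ a b → fromℤ a ℚ.+ fromℤ b ≡ fromℤ (a + b)
fromℤ-+ a b = trans (ℚₚ./-cong {p₂ = a + b} {q₂ = 1} (cong₂ _+_ (*-identityʳ a) (*-identityʳ b)) refl) (/1≡fromℤ (a + b))

fromℤ-* : ∀ a b → fromℤ a ℚ.* fromℤ b ≡ fromℤ (a * b)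
fromℤ-* a b = /1≡fromℤ (a * b)

fromℤ-cancel-< : ∀ {a b} → fromℤ a ℚ.< fromℤ b → a < b
fromℤ-cancel-< {a} {b} (ℚ.*<* a*1<b*1) = subst₂ _<_ (*-identityʳ a) (*-identityʳ b) a*1<b*1

fromℤ-cancel-≤ : ∀ {a b} → fromℤ a ℚ.≤ fromℤ b → a ≤ᶻ b
fromℤ-cancel-≤ {a} {b} (ℚ.*≤* a*1≤b*1) = subst₂ _≤ᶻ_ (*-identityʳ a) (*-identityʳ b) a*1≤b*1

fromℤ-linear : ∀ c₀ c₁ c₂ n m →
  c₀ / 1 ℚ.+ c₁ / 1 ℚ.* (+ n / 1) ℚ.+ c₂ / 1 ℚ.* (+ m / 1) ≡ fromℤ (c₀ + c₁ * + n + c₂ * + m)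
fromℤ-linear c₀ c₁ c₂ n m
  rewrite /1≡fromℤ c₀ | /1≡fromℤ c₁ | /1≡fromℤ c₂ | /1≡fromℤ (+ n) | /1≡fromℤ (+ m)
        | fromℤ-* c₁ (+ n) | fromℤ-* c₂ (+ m) | fromℤ-+ c₀ (c₁ * + n) | fromℤ-+ (c₀ + c₁ * + n) (c₂ * + m) = refl

module _ (k : ℚ) (0<k : 0ℚ ℚ.< k) where
  private
    instance
      k-positive : ℚ.Positive k
      k-positive = ℚ.positive 0<k

    scale-0≤ : ∀ {a} → 0ℚ ℚ.≤ a → 0ℚ ℚ.≤ k ℚ.* a
    scale-0≤ {a} h = subst (ℚ._≤ k ℚ.* a) (ℚₚ.*-zeroʳ k) (ℚₚ.*-monoˡ-≤-nonNeg k ⦃ ℚ.nonNegative (ℚₚ.<⇒≤ 0<k) ⦄ h)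

    scale-0< : ∀ {a} → 0ℚ ℚ.< a → 0ℚ ℚ.< k ℚ.* a
    scale-0< {a} h = subst (ℚ._< k ℚ.* a) (ℚₚ.*-zeroʳ k) (ℚₚ.*-monoʳ-<-pos k h)

    scale-<0 : ∀ {a} → a ℚ.< 0ℚ → k ℚ.* a ℚ.< 0ℚ
    scale-<0 {a} h = subst (k ℚ.* a ℚ.<_) (ℚₚ.*-zeroʳ k) (ℚₚ.*-monoʳ-<-pos k h)

    scale-< : ∀ {x y} → x ℚ.< y → (k ℚ.* k) ℚ.* x ℚ.< (k ℚ.* k) ℚ.* y
    scale-< = ℚₚ.*-monoʳ-<-pos (k ℚ.* k) ⦃ ℚ.positive (scale-0< 0<k) ⦄

    square-scale : ∀ {a A} → k ℚ.* a ≡ fromℤ A → (k ℚ.* k) ℚ.* (a ℚ.* a) ≡ fromℤ (A * A)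
    square-scale {a} {A} ka≡A = begin
      (k ℚ.* k) ℚ.* (a ℚ.* a)    ≡⟨ e k a ⟩
      (k ℚ.* a) ℚ.* (k ℚ.* a)    ≡⟨ cong (λ t → t ℚ.* t) ka≡A ⟩
      fromℤ A ℚ.* fromℤ A        ≡⟨ fromℤ-* A A ⟩
      fromℤ (A * A)              ∎
      where
      e : ∀ k a → (k ℚ.* k) ℚ.* (a ℚ.* a) ≡ (k ℚ.* a) ℚ.* (k ℚ.* a)
      e = RingSolver.solve-∀ ℚ-ring

    5square-scale : ∀ {b B} → k ℚ.* b ≡ fromℤ B → (k ℚ.* k) ℚ.* (five ℚ.* (b ℚ.* b)) ≡ fromℤ (+ 5 * (B * B))
    5square-scale {b} {B} kb≡B = begin
      (k ℚ.* k) ℚ.* (five ℚ.* (b ℚ.* b))   ≡⟨ e k b ⟩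
      five ℚ.* ((k ℚ.* k) ℚ.* (b ℚ.* b))   ≡⟨ cong₂ ℚ._*_ (/1≡fromℤ (+ 5)) (square-scale kb≡B) ⟩
      fromℤ (+ 5) ℚ.* fromℤ (B * B)        ≡⟨ fromℤ-* (+ 5) (B * B) ⟩
      fromℤ (+ 5 * (B * B))                ∎
      where
      e : ∀ k b → (k ℚ.* k) ℚ.* (five ℚ.* (b ℚ.* b)) ≡ five ℚ.* ((k ℚ.* k) ℚ.* (b ℚ.* b))
      e = RingSolver.solve-∀ ℚ-ring

  Pos⇒Pos√5 : ∀ {x A B} → k ℚ.* re x ≡ fromℤ A → k ℚ.* ir x ≡ fromℤ B → Pos x → Pos√5 A B
  Pos⇒Pos√5 {A = A} {B} ka≡A kb≡B (pos-nn {a} {b} 0≤a 0≤b 0<a+b) =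
    pos-nn (fromℤ-cancel-≤ (subst (0ℚ ℚ.≤_) ka≡A (scale-0≤ 0≤a))) (fromℤ-cancel-≤ (subst (0ℚ ℚ.≤_) kb≡B (scale-0≤ 0≤b)))
      (fromℤ-cancel-< (subst (0ℚ ℚ.<_) (trans (ℚₚ.*-distribˡ-+ k a b) (trans (cong₂ ℚ._+_ ka≡A kb≡B) (fromℤ-+ A B)))
                                        (scale-0< 0<a+b)))
  Pos⇒Pos√5 ka≡A kb≡B (pos-pn 0<a b<0 5b²<a²) =
    pos-pn (fromℤ-cancel-< (subst (0ℚ ℚ.<_) ka≡A (scale-0< 0<a))) (fromℤ-cancel-< (subst (ℚ._< 0ℚ) kb≡B (scale-<0 b<0)))
      (fromℤ-cancel-< (subst₂ ℚ._<_ (5square-scale kb≡B) (square-scale ka≡A) (scale-< 5b²<a²)))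
  Pos⇒Pos√5 ka≡A kb≡B (pos-np a<0 0<b a²<5b²) =
    pos-np (fromℤ-cancel-< (subst (ℚ._< 0ℚ) ka≡A (scale-<0 a<0))) (fromℤ-cancel-< (subst (0ℚ ℚ.<_) kb≡B (scale-0< 0<b)))
      (fromℤ-cancel-< (subst₂ ℚ._<_ (square-scale ka≡A) (5square-scale kb≡B) (scale-< a²<5b²)))

½ : ℚ
½ = + 1 / 2

c₀ : Q5
c₀ = ½ ⊹ (-[1+ 0 ] / 10) √5

c≡c₀ : ∀ c → c *₅ (√5 *₅ φ) ≡ one₅ → c ≡ c₀
c≡c₀ (u ⊹ v √5) c√5φ≡1 = cong₂ _⊹_√5
  (trans (eu u v) (cong₂ (λ E₁ E₂ → ½ ℚ.* (E₁ ℚ.- E₂)) (cong re c√5φ≡1) (cong ir c√5φ≡1)))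
  (trans (ev u v) (cong₂ (λ E₁ E₂ → (-[1+ 0 ] / 10) ℚ.* E₁ ℚ.+ ½ ℚ.* E₂) (cong re c√5φ≡1) (cong ir c√5φ≡1)))
  where
  -- √5 φ = r₁ + r₂ √5
  r₁ r₂ : ℚ
  r₁ = 0ℚ ℚ.* ½ ℚ.+ five ℚ.* (1ℚ ℚ.* ½)
  r₂ = 0ℚ ℚ.* ½ ℚ.+ 1ℚ ℚ.* ½
  eu : ∀ u v → u ≡ ½ ℚ.* ((u ℚ.* r₁ ℚ.+ five ℚ.* (v ℚ.* r₂)) ℚ.- (u ℚ.* r₂ ℚ.+ v ℚ.* r₁))
  eu = RingSolver.solve-∀ ℚ-ring
  ev : ∀ u v → v ≡ (-[1+ 0 ] / 10) ℚ.* (u ℚ.* r₁ ℚ.+ five ℚ.* (v ℚ.* r₂)) ℚ.+ ½ ℚ.* (u ℚ.* r₂ ℚ.+ v ℚ.* r₁)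
  ev = RingSolver.solve-∀ ℚ-ring

-- The two halves of Approx (+ n , + m) φ⁻¹ say φ⁻¹ ∓ √5 (m − φn) > 0.  One is √5 (c₀ ∓ (m − φn)),
-- as √5 c₀ = φ⁻¹; the other is φ⁻¹ plus a positive multiple of √5, where 2φ⁻¹ = √5 − 1.
floor⇒above : ∀ n m → Pos (φ *₅ fromℕ₅ n -₅ fromℕ₅ m) → Posφ (φ⁻¹ ⊖ √5·err (+ n , + m))
floor⇒above n m φn>m = subst₂ Pos√5 (e (+ n) (+ m)) (e′ (+ n) (+ m))
  (Pos√5-+[√5-1] (Pos√5-*√5 (Pos⇒Pos√5 (+ 2 / 1) (ℚₚ.positive⁻¹ _)
    (trans (re-eq (+ n / 1) (+ m / 1)) (fromℤ-linear 0ℤ 1ℤ -[1+ 1 ] n m))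
    (trans (ir-eq (+ n / 1) (+ m / 1)) (fromℤ-linear 0ℤ 1ℤ 0ℤ n m)) φn>m)))
  where
  re-eq : ∀ N M → (+ 2 / 1) ℚ.* ((½ ℚ.* N ℚ.+ five ℚ.* (½ ℚ.* 0ℚ)) ℚ.- M) ≡ (0ℤ / 1) ℚ.+ (1ℤ / 1) ℚ.* N ℚ.+ (-[1+ 1 ] / 1) ℚ.* M
  re-eq = RingSolver.solve-∀ ℚ-ring
  ir-eq : ∀ N M → (+ 2 / 1) ℚ.* ((½ ℚ.* 0ℚ ℚ.+ ½ ℚ.* N) ℚ.- 0ℚ) ≡ (0ℤ / 1) ℚ.+ (1ℤ / 1) ℚ.* N ℚ.+ (0ℤ / 1) ℚ.* M
  ir-eq = RingSolver.solve-∀ ℚ-ring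
  e : ∀ n m → + 5 * (0ℤ + 1ℤ * n + 0ℤ * m) - 1ℤ ≡ (-1ℤ - (- m - (n + n))) + (-1ℤ - (- m - (n + n))) + (1ℤ - (m + m - n))
  e = solve-∀
  e′ : ∀ n m → 0ℤ + 1ℤ * n + -[1+ 1 ] * m + 1ℤ ≡ 1ℤ - (m + m - n)
  e′ = solve-∀

floor-c₀⇒below : ∀ n m → Pos (c₀ -₅ (φ *₅ fromℕ₅ n -₅ fromℕ₅ m)) → Posφ (φ⁻¹ ⊕ √5·err (+ n , + m))
floor-c₀⇒below n m φn-m<c₀ = Pos√5-/√5 (subst₂ Pos√5 (e (+ n) (+ m)) (e′ (+ n) (+ m))
  (Pos⇒Pos√5 (+ 10 / 1) (ℚₚ.positive⁻¹ _)
    (trans (re-eq (+ n / 1) (+ m / 1)) (fromℤ-linear (+ 5) -[1+ 4 ] (+ 10) n m))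
    (trans (ir-eq (+ n / 1) (+ m / 1)) (fromℤ-linear -[1+ 0 ] -[1+ 4 ] 0ℤ n m)) φn-m<c₀))
  where
  re-eq : ∀ N M → (+ 10 / 1) ℚ.* (½ ℚ.- ((½ ℚ.* N ℚ.+ five ℚ.* (½ ℚ.* 0ℚ)) ℚ.- M))
                  ≡ (+ 5 / 1) ℚ.+ (-[1+ 4 ] / 1) ℚ.* N ℚ.+ (+ 10 / 1) ℚ.* M
  re-eq = RingSolver.solve-∀ ℚ-ring
  ir-eq : ∀ N M → (+ 10 / 1) ℚ.* ((-[1+ 0 ] / 10) ℚ.- ((½ ℚ.* 0ℚ ℚ.+ ½ ℚ.* N) ℚ.- 0ℚ))
                  ≡ (-[1+ 0 ] / 1) ℚ.+ (-[1+ 4 ] / 1) ℚ.* N ℚ.+ (0ℤ / 1) ℚ.* M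
  ir-eq = RingSolver.solve-∀ ℚ-ring
  e : ∀ n m → + 5 + -[1+ 4 ] * n + + 10 * m ≡ + 5 * (1ℤ + (m + m - n))
  e = solve-∀
  e′ : ∀ n m → -[1+ 0 ] + -[1+ 4 ] * n + 0ℤ * m ≡ (-1ℤ + (- m - (n + n))) + (-1ℤ + (- m - (n + n))) + (1ℤ + (m + m - n))
  e′ = solve-∀

ceil⇒below : ∀ n m → Pos (fromℕ₅ m -₅ φ *₅ fromℕ₅ n) → Posφ (φ⁻¹ ⊕ √5·err (+ n , + m))
ceil⇒below n m m>φn = subst₂ Pos√5 (e (+ n) (+ m)) (e′ (+ n) (+ m))
  (Pos√5-+[√5-1] (Pos√5-*√5 (Pos⇒Pos√5 (+ 2 / 1) (ℚₚ.positive⁻¹ _)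
    (trans (re-eq (+ n / 1) (+ m / 1)) (fromℤ-linear 0ℤ -1ℤ (+ 2) n m))
    (trans (ir-eq (+ n / 1) (+ m / 1)) (fromℤ-linear 0ℤ -1ℤ 0ℤ n m)) m>φn)))
  where
  re-eq : ∀ N M → (+ 2 / 1) ℚ.* (M ℚ.- (½ ℚ.* N ℚ.+ five ℚ.* (½ ℚ.* 0ℚ))) ≡ (0ℤ / 1) ℚ.+ (-1ℤ / 1) ℚ.* N ℚ.+ (+ 2 / 1) ℚ.* M
  re-eq = RingSolver.solve-∀ ℚ-ring
  ir-eq : ∀ N M → (+ 2 / 1) ℚ.* (0ℚ ℚ.- (½ ℚ.* 0ℚ ℚ.+ ½ ℚ.* N)) ≡ (0ℤ / 1) ℚ.+ (-1ℤ / 1) ℚ.* N ℚ.+ (0ℤ / 1) ℚ.* M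
  ir-eq = RingSolver.solve-∀ ℚ-ring
  e : ∀ n m → + 5 * (0ℤ + -1ℤ * n + 0ℤ * m) - 1ℤ ≡ (-1ℤ + (- m - (n + n))) + (-1ℤ + (- m - (n + n))) + (1ℤ + (m + m - n))
  e = solve-∀
  e′ : ∀ n m → 0ℤ + -1ℤ * n + + 2 * m + 1ℤ ≡ 1ℤ + (m + m - n)
  e′ = solve-∀

ceil-c₀⇒above : ∀ n m → Pos (c₀ -₅ (fromℕ₅ m -₅ φ *₅ fromℕ₅ n)) → Posφ (φ⁻¹ ⊖ √5·err (+ n , + m))
ceil-c₀⇒above n m m-φn<c₀ = Pos√5-/√5 (subst₂ Pos√5 (e (+ n) (+ m)) (e′ (+ n) (+ m))
  (Pos⇒Pos√5 (+ 10 / 1) (ℚₚ.positive⁻¹ _)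
    (trans (re-eq (+ n / 1) (+ m / 1)) (fromℤ-linear (+ 5) (+ 5) -[1+ 9 ] n m))
    (trans (ir-eq (+ n / 1) (+ m / 1)) (fromℤ-linear -[1+ 0 ] (+ 5) 0ℤ n m)) m-φn<c₀))
  where
  re-eq : ∀ N M → (+ 10 / 1) ℚ.* (½ ℚ.- (M ℚ.- (½ ℚ.* N ℚ.+ five ℚ.* (½ ℚ.* 0ℚ))))
                  ≡ (+ 5 / 1) ℚ.+ (+ 5 / 1) ℚ.* N ℚ.+ (-[1+ 9 ] / 1) ℚ.* M
  re-eq = RingSolver.solve-∀ ℚ-ring
  ir-eq : ∀ N M → (+ 10 / 1) ℚ.* ((-[1+ 0 ] / 10) ℚ.- (0ℚ ℚ.- (½ ℚ.* 0ℚ ℚ.+ ½ ℚ.* N)))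
                  ≡ (-[1+ 0 ] / 1) ℚ.+ (+ 5 / 1) ℚ.* N ℚ.+ (0ℤ / 1) ℚ.* M
  ir-eq = RingSolver.solve-∀ ℚ-ring
  e : ∀ n m → + 5 + + 5 * n + -[1+ 9 ] * m ≡ + 5 * (1ℤ - (m + m - n))
  e = solve-∀
  e′ : ∀ n m → -[1+ 0 ] + + 5 * n + 0ℤ * m ≡ (-1ℤ - (- m - (n + n))) + (-1ℤ - (- m - (n + n))) + (1ℤ - (m + m - n))
  e′ = solve-∀

φn≢m : ∀ {n m} → 1 ≤ n → φ *₅ fromℕ₅ n ≡ fromℕ₅ m → ⊥
φn≢m {suc n} _ φn≡m = ℕₚ.1+n≢0 (+-injective (cong ℚ.↥_ (trans (sym (/1≡fromℤ (+ suc n))) N≡0)))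
  where
  e : ∀ N → N ≡ (+ 2 / 1) ℚ.* (½ ℚ.* 0ℚ ℚ.+ ½ ℚ.* N)
  e = RingSolver.solve-∀ ℚ-ring
  N≡0 : + suc n / 1 ≡ 0ℚ
  N≡0 = trans (e (+ suc n / 1)) (cong ((+ 2 / 1) ℚ.*_) (cong ir φn≡m))

floor-approx : ∀ {n m} → 1 ≤ n → IsFloor (φ *₅ fromℕ₅ n) m → φ *₅ fromℕ₅ n -₅ fromℕ₅ m <₅ c₀ → Approx (+ n , + m) φ⁻¹
floor-approx {n} {m} _ (inj₁ m<φn , _) φn-m<c₀ = floor⇒above n m m<φn , floor-c₀⇒below n m φn-m<c₀
floor-approx {n} {m} 1≤n (inj₂ m≡φn , _) _ = ⊥-elim (φn≢m {n} {m} 1≤n (sym m≡φn))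

ceil-approx : ∀ {n m} → 1 ≤ n → IsCeil (φ *₅ fromℕ₅ n) m → fromℕ₅ m -₅ φ *₅ fromℕ₅ n <₅ c₀ → Approx (+ n , + m) φ⁻¹
ceil-approx {n} {m} _ (inj₁ φn<m , _) m-φn<c₀ = ceil-c₀⇒above n m m-φn<c₀ , ceil⇒below n m φn<m
ceil-approx {n} {m} 1≤n (inj₂ φn≡m , _) _ = ⊥-elim (φn≢m {n} {m} 1≤n φn≡m)

slow-walk-through : ∀ {n m} (P : ℕ → Set) → 1 ≤ n → Approx (+ n , + m) φ⁻¹ → P m →
  ∃ λ a₁ → ∃ λ a₂ → ∃ λ s → Slow n a₁ a₂ s × P (w a₁ a₂ (suc s))
slow-walk-through {n} {m} P 1≤n approx Pm = a₁ , a₂ , suc s , walkThrough-slow W approx , subst P (sym w-s+1≡y) Pm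
  where
  W : WalkThrough n m
  W = walkThrough m ℕₚ.≤-refl 1≤n (approx⇒1≤m 1≤n approx)
  open WalkThrough W

proposition13 : (c : Q5) → c *₅ (√5 *₅ φ) ≡ one₅ →
    (n : ℕ) → 2 ≤ n →
    ((m : ℕ) → IsFloor (φ *₅ fromℕ₅ n) m → (φ *₅ fromℕ₅ n) -₅ fromℕ₅ m <₅ c → InD n) ×
    ((m : ℕ) → IsCeil (φ *₅ fromℕ₅ n) m → fromℕ₅ m -₅ (φ *₅ fromℕ₅ n) <₅ c → InU n)
proposition13 c c√5φ≡1 n 2≤n =
  (λ m isFloor φn-m<c → slow-walk-through {n} {m} (IsFloor (φ *₅ fromℕ₅ n)) 1≤n
                          (floor-approx {n} {m} 1≤n isFloor (below-c₀ φn-m<c)) isFloor) ,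
  (λ m isCeil m-φn<c → slow-walk-through {n} {m} (IsCeil (φ *₅ fromℕ₅ n)) 1≤n
                         (ceil-approx {n} {m} 1≤n isCeil (below-c₀ m-φn<c)) isCeil)
  where
  1≤n : 1 ≤ n
  1≤n = ℕₚ.≤-trans (s≤s z≤n) 2≤n
  below-c₀ : ∀ {x} → x <₅ c → x <₅ c₀
  below-c₀ {x} = subst (x <₅_) (c≡c₀ c c√5φ≡1)
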